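{- For the infinite hexagonal grid $HEX$, the minimum density of a RED:LD set is $\textrm{RED:LD}\%(HEX) = \frac{1}{2}$.
   Context: $HEX$ is the infinite 3-regular hexagonal (honeycomb) grid graph. $N(v)$ denotes the open neighborhood of $v$. A set $S \subseteq V(G)$ is a locating-dominating (LD) set if for all $u,v \in V(G)-S$: $N(v)\cap S \neq \varnothing$, and if $u \ne v$ then $N(v) \cap S \neq N(u) \cap S$. A RED:LD set is an LD set $S$ such that $S-\{v\}$ is an LD set for every $v \in S$. For an infinite graph, the density of $S$ is the ratio of the number of detectors to the number of vertices (in the usual limiting sense), and $\textrm{RED:LD}\%(G)$ is the minimum density of a RED:LD set. -}

module Defs where

open import Data.Bool using (Bool; true; false; _∧_; _∨_; not; if_then_else_)
open import Data.Nat as ℕ using (ℕ; zero; suc; _%_)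
open import Data.Integer as ℤ using (ℤ; +_; -[1+_]; ∣_∣)
open import Data.Product using (Σ; ∃; _×_; _,_)
open import Data.Product.Properties using (≡-dec)
open import Data.List using (List; []; _∷_; map; foldr; concatMap)
open import Data.Bool.ListAction using (any)
open import Data.List.Membership.Propositional using (_∈_)
open import Data.Rational as ℚ using (ℚ; _/_; ½; Positive)
open import Relation.Binary.PropositionalEquality using (_≡_)
open import Relation.Nullary using (¬_; ⌊_⌋)
open import Relation.Nullary.Decidable using (⌊_⌋)
open import Function.Bundles using (_⇔_)

-- The infinite hexagonal (honeycomb) grid HEX, in "brick wall" coordinates.
-- This is a 3-regular graph isomorphic to the honeycomb lattice.

V : Set
V = ℤ × ℤ

_≟V_ : (u v : V) → Relation.Nullary.Dec (u ≡ v)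
_≟V_ = ≡-dec ℤ._≟_ ℤ._≟_

isEven : ℤ → Bool
isEven z = ⌊ (∣ z ∣ % 2) ℕ.≟ 0 ⌋

nbrs : V → List V
nbrs (x , y) =
  (x ℤ.+ ℤ.1ℤ , y) ∷ (x ℤ.- ℤ.1ℤ , y) ∷
  (x , (if isEven (x ℤ.+ y) then y ℤ.+ ℤ.1ℤ else y ℤ.- ℤ.1ℤ)) ∷ []

Adj : V → V → Set
Adj u w = w ∈ nbrs u

VSet : Set
VSet = V → Bool

_∈S_ : V → VSet → Set
v ∈S S = S v ≡ true

remove : VSet → V → VSet
remove S v w = S w ∧ not ⌊ w ≟V v ⌋

IsLD : VSet → Set
IsLD S =
  (∀ v → ¬ (v ∈S S) → ∃ λ w → Adj v w × w ∈S S) ×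
  (∀ u v → ¬ (u ∈S S) → ¬ (v ∈S S) → ¬ (u ≡ v) →
     ¬ (∀ w → ((Adj u w × w ∈S S) ⇔ (Adj v w × w ∈S S))))

IsRedLD : VSet → Set
IsRedLD S = IsLD S × (∀ v → v ∈S S → IsLD (remove S v))

-- Density: limsup over balls B_r(o) (graph distance) around o = (0,0)
-- of |S ∩ B_r(o)| / |B_r(o)|.

origin : V
origin = (+ 0 , + 0)

-- inBall r v  iff  dist(origin , v) ≤ r
inBall : ℕ → V → Bool
inBall zero v = ⌊ v ≟V origin ⌋
inBall (suc r) v = inBall r v ∨ any (inBall r) (nbrs v)

range : ℕ → List ℤ
range zero = + 0 ∷ []
range (suc n) = (+ suc n) ∷ -[1+ n ] ∷ range n

-- the box [-r,r]², which contains B_r(origin) (each edge changes each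
-- coordinate by at most 1)
box : ℕ → List V
box r = concatMap (λ x → map (λ y → (x , y)) (range r)) (range r)

countBool : List V → (V → Bool) → ℕ
countBool [] P = 0
countBool (v ∷ vs) P = (if P v then 1 else 0) ℕ.+ countBool vs P

ballCount : VSet → ℕ → ℕ
ballCount S r = countBool (box r) (λ v → inBall r v ∧ S v)

ballSize : ℕ → ℕ
ballSize r = countBool (box r) (inBall r)

fromℕ : ℕ → ℚ
fromℕ n = + n / 1

-- ratio_r(S) ≤ q   (written without division)
RatioLE : VSet → ℕ → ℚ → Set
RatioLE S r q = fromℕ (ballCount S r) ℚ.≤ q ℚ.* fromℕ (ballSize r)

RatioGE : VSet → ℕ → ℚ → Set
RatioGE S r q = q ℚ.* fromℕ (ballSize r) ℚ.≤ fromℕ (ballCount S r)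

-- limsup_r ratio_r(S) ≤ q
DensityLE : VSet → ℚ → Set
DensityLE S q = ∀ (ε : ℚ) → Positive ε →
  ∃ λ R → ∀ r → R ℕ.≤ r → RatioLE S r (q ℚ.+ ε)

-- limsup_r ratio_r(S) ≥ q
DensityGE : VSet → ℚ → Set
DensityGE S q = ∀ (ε : ℚ) → Positive ε →
  ∀ R → ∃ λ r → R ℕ.≤ r × RatioGE S r (q ℚ.- ε)

DensityEq : VSet → ℚ → Set
DensityEq S q = DensityLE S q × DensityGE S q

-- Lower bound: in a RED:LD set S every closed neighbourhood N[u] contains two detectors.  If
-- u ∈ S, then S - {u} must still dominate u; if u ∉ S is dominated by w, then S - {w} dominates u
-- by a second detector.  Double counting over the ball B_r gives 2|B_r| ≤ 4|S ∩ B_{r+1}|, and as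
-- |B_r| grows only quadratically, |B_{r+1}| / |B_r| comes arbitrarily close to 1 for arbitrarily
-- large r.
-- Upper bound: let S be the columns x = 0, x > 0 odd and x < 0 even.  A vertex outside S has its
-- detectors exactly on its two horizontal neighbours, which keeps S - {d} locating-dominating for
-- every d.  The reflection x ↦ -x maps detectors off column 0 to non-detectors, so
-- 2|S ∩ B_r| ≤ |B_r| + 2r + 1, while |B_r| grows quadratically.
module Submission where

open import Defs
open import Data.Product using (∃; _×_)
open import Data.Rational using (½)

open import Data.Bool using (Bool; true; false; not; _∧_; _∨_; if_then_else_)
open import Data.Bool.ListAction using (any)
open import Data.Bool.Properties
  using (not-involutive; not-injective; not-¬; ¬-not; ∨-zeroʳ; ∨-assoc; ∨-comm; ∧-zeroʳ; ∧-identityʳ; ∧-conicalˡ; ∧-conicalʳ)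
open import Data.Empty using (⊥; ⊥-elim)
open import Data.Integer as ℤ using (ℤ; +_; -[1+_]; ∣_∣; 0ℤ; 1ℤ; -1ℤ; +≤+)
import Data.Integer.Properties as ℤP
import Data.Integer.Tactic.RingSolver as ℤSolver
open import Data.List using (List; []; _∷_; _++_; length; map; concatMap; cartesianProduct)
open import Data.List.Properties using (length-++; length-map)
open import Data.List.Membership.Propositional using (_∈_)
open import Data.List.Membership.Propositional.Properties using (∈-cartesianProduct⁺; ∈-cartesianProduct⁻; ∈-map⁺)
open import Data.List.Relation.Unary.All as All using ([]; _∷_)
open import Data.List.Relation.Unary.AllPairs using ([]; _∷_)
open import Data.List.Relation.Unary.Any using (here; there; _─_)
open import Data.List.Relation.Unary.Unique.Propositional using (Unique)
open import Data.List.Relation.Unary.Unique.Propositional.Properties using (cartesianProduct⁺)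
open import Data.Nat as ℕ using (ℕ; zero; suc; _+_; _*_; _^_; _≤_; _<_; z≤n; s≤s; _≤?_)
open import Data.Nat.Coprimality using (1-coprimeTo)
import Data.Nat.Coprimality as Coprimality
open import Data.Nat.DivMod using (_/_; m/n*n≤m; m≡m%n+[m/n]*n; m%n<n; m*n/n≡m; /-monoˡ-≤)
open import Data.Nat.ListAction using (sum)
open import Data.Nat.Properties
import Data.Nat.Tactic.RingSolver as ℕSolver
open import Data.Product using (_,_; proj₁; proj₂)
open import Data.Rational as ℚ using (mkℚ; Positive; toℚᵘ)
import Data.Rational.Properties as ℚP
open import Data.Rational.Unnormalised as ℚᵘ using (mkℚᵘ; *≤*)
import Data.Rational.Unnormalised.Properties as ℚᵘP
open import Data.Sum using (_⊎_; inj₁; inj₂)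
open import Function using (_∘_; id)
open import Function.Bundles using (_⇔_; Equivalence; mk⇔)
open import Relation.Binary.PropositionalEquality
open import Relation.Nullary using (¬_; Dec; yes; no; contradiction)
open import Relation.Nullary.Decidable using (⌊_⌋)
open import Algebra.Properties.AbelianGroup ℤP.+-0-abelianGroup using () renaming (∙-cancelˡ to +-cancelˡ; ∙-cancelʳ to +-cancelʳ)
open import Algebra.Properties.CommutativeSemigroup +-commutativeSemigroup using () renaming (interchange to +-interchange)

z+1-1≡z : ∀ z → (z ℤ.+ 1ℤ) ℤ.- 1ℤ ≡ z
z+1-1≡z = ℤSolver.solve-∀

z-1+1≡z : ∀ z → (z ℤ.- 1ℤ) ℤ.+ 1ℤ ≡ z
z-1+1≡z = ℤSolver.solve-∀

isEven-+suc : ∀ n → isEven (+ suc n) ≡ not (isEven (+ n))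
isEven-+suc zero = refl
isEven-+suc (suc n) = trans (sym (not-involutive _)) (cong not (sym (isEven-+suc n)))

isEven-suc : ∀ z → isEven (z ℤ.+ 1ℤ) ≡ not (isEven z)
isEven-suc (+ n) rewrite +-comm n 1 = isEven-+suc n
isEven-suc -[1+ zero ] = refl
isEven-suc -[1+ suc n ] = isEven-+suc n

isEven-pred : ∀ z → isEven (z ℤ.- 1ℤ) ≡ not (isEven z)
isEven-pred z = trans (sym (not-involutive _)) (cong not (sym isEven-z))
  where
  isEven-z : isEven z ≡ not (isEven (z ℤ.- 1ℤ))
  isEven-z = trans (cong isEven (sym (z-1+1≡z z))) (isEven-suc (z ℤ.- 1ℤ))

isEven-neg-+ : ∀ x y → isEven (ℤ.- x ℤ.+ y) ≡ isEven (x ℤ.+ y)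
isEven-neg-+ (+ n) y = isEven-neg-+-pos n y
  where
  isEven-neg-+-pos : ∀ n y → isEven (ℤ.- (+ n) ℤ.+ y) ≡ isEven (+ n ℤ.+ y)
  isEven-neg-+-pos zero y = refl
  isEven-neg-+-pos (suc n) y = begin
    isEven (ℤ.- (+ suc n) ℤ.+ y)         ≡⟨ cong isEven (left n y) ⟩
    isEven ((ℤ.- (+ n) ℤ.+ y) ℤ.- 1ℤ)    ≡⟨ isEven-pred (ℤ.- (+ n) ℤ.+ y) ⟩
    not (isEven (ℤ.- (+ n) ℤ.+ y))       ≡⟨ cong not (isEven-neg-+-pos n y) ⟩
    not (isEven (+ n ℤ.+ y))             ≡⟨ isEven-suc (+ n ℤ.+ y) ⟨
    isEven ((+ n ℤ.+ y) ℤ.+ 1ℤ)          ≡⟨ cong isEven (right n y) ⟩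
    isEven (+ suc n ℤ.+ y)               ∎
    where
    open ≡-Reasoning
    left-ring : ∀ k y → ℤ.- (1ℤ ℤ.+ k) ℤ.+ y ≡ (ℤ.- k ℤ.+ y) ℤ.- 1ℤ
    left-ring = ℤSolver.solve-∀
    right-ring : ∀ k y → (k ℤ.+ y) ℤ.+ 1ℤ ≡ (1ℤ ℤ.+ k) ℤ.+ y
    right-ring = ℤSolver.solve-∀
    left : ∀ n y → ℤ.- (+ suc n) ℤ.+ y ≡ (ℤ.- (+ n) ℤ.+ y) ℤ.- 1ℤ
    left n y = trans (cong (λ k → ℤ.- k ℤ.+ y) (ℤP.pos-+ 1 n)) (left-ring (+ n) y)
    right : ∀ n y → (+ n ℤ.+ y) ℤ.+ 1ℤ ≡ + suc n ℤ.+ y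
    right n y = trans (right-ring (+ n) y) (cong (ℤ._+ y) (sym (ℤP.pos-+ 1 n)))
isEven-neg-+ -[1+ n ] y = sym (isEven-neg-+ (+ suc n) y)

isEven-east : ∀ x y → isEven ((x ℤ.+ 1ℤ) ℤ.+ y) ≡ not (isEven (x ℤ.+ y))
isEven-east x y = trans (cong isEven (shuffle x y)) (isEven-suc (x ℤ.+ y))
  where
  shuffle : ∀ x y → (x ℤ.+ 1ℤ) ℤ.+ y ≡ (x ℤ.+ y) ℤ.+ 1ℤ
  shuffle = ℤSolver.solve-∀

east west vert : V → V
east (x , y) = (x ℤ.+ 1ℤ , y)
west (x , y) = (x ℤ.- 1ℤ , y)
vert (x , y) = (x , (if isEven (x ℤ.+ y) then y ℤ.+ 1ℤ else y ℤ.- 1ℤ))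

pattern east-adj = here refl
pattern west-adj = there (here refl)
pattern vert-adj = there (there (here refl))

west-east : ∀ v → west (east v) ≡ v
west-east (x , y) = cong (_, y) (z+1-1≡z x)

east-west : ∀ v → east (west v) ≡ v
east-west (x , y) = cong (_, y) (z-1+1≡z x)

vert-involutive : ∀ v → vert (vert v) ≡ v
vert-involutive (x , y) with isEven (x ℤ.+ y) in eq
... | true rewrite sym (ℤP.+-assoc x y 1ℤ) | isEven-suc (x ℤ.+ y) | eq = cong (x ,_) (z+1-1≡z y)
... | false rewrite sym (ℤP.+-assoc x y (ℤ.- 1ℤ)) | isEven-pred (x ℤ.+ y) | eq = cong (x ,_) (z-1+1≡z y)

vert-≢ : ∀ v → ¬ vert v ≡ v
vert-≢ (x , y) eq with isEven (x ℤ.+ y)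
... | true = contradiction (+-cancelˡ y 1ℤ 0ℤ (trans (cong proj₂ eq) (sym (ℤP.+-identityʳ y)))) λ ()
... | false = contradiction (+-cancelˡ y (ℤ.- 1ℤ) 0ℤ (trans (cong proj₂ eq) (sym (ℤP.+-identityʳ y)))) λ ()

Adj-sym : ∀ u w → Adj u w → Adj w u
Adj-sym u _ east-adj = there (here (sym (west-east u)))
Adj-sym u _ west-adj = here (sym (east-west u))
Adj-sym u _ vert-adj = there (there (here (sym (vert-involutive u))))

injective-by : ∀ (τ σ : V → V) → (∀ v → σ (τ v) ≡ v) → ∀ {a b} → τ a ≡ τ b → a ≡ b
injective-by τ σ σ∘τ≗id {a} {b} eq = trans (sym (σ∘τ≗id a)) (trans (cong σ eq) (σ∘τ≗id b))

bit : Bool → ℕ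
bit b = if b then 1 else 0

countBool-const-true : ∀ xs → countBool xs (λ _ → true) ≡ length xs
countBool-const-true [] = refl
countBool-const-true (x ∷ xs) = cong suc (countBool-const-true xs)

countBool-≤-length : ∀ xs (P : V → Bool) → countBool xs P ≤ length xs
countBool-≤-length [] P = z≤n
countBool-≤-length (x ∷ xs) P with P x
... | true = s≤s (countBool-≤-length xs P)
... | false = m≤n⇒m≤1+n (countBool-≤-length xs P)

countBool-mono : ∀ xs {P Q : V → Bool} → (∀ {v} → v ∈S P → v ∈S Q) → countBool xs P ≤ countBool xs Q
countBool-mono [] P⊆Q = z≤n
countBool-mono (x ∷ xs) {P} {Q} P⊆Q with P x in Px | Q x in Qx
... | false | _ = ≤-trans (countBool-mono xs P⊆Q) (m≤n+m _ _)
... | true | true = s≤s (countBool-mono xs P⊆Q)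
... | true | false = contradiction (trans (sym Qx) (P⊆Q Px)) λ ()

countBool-split : ∀ xs (P Q : V → Bool) →
  countBool xs P ≡ countBool xs (λ v → P v ∧ Q v) + countBool xs (λ v → P v ∧ not (Q v))
countBool-split [] P Q = refl
countBool-split (x ∷ xs) P Q with P x | Q x
... | false | _ = countBool-split xs P Q
... | true | true = cong suc (countBool-split xs P Q)
... | true | false = trans (cong suc (countBool-split xs P Q)) (sym (+-suc _ _))

countBool-─ : ∀ {y} (ys : List V) (y∈ : y ∈ ys) (P : V → Bool) → P y ≡ true →
  countBool ys P ≡ suc (countBool (ys ─ y∈) P)
countBool-─ (y ∷ ys) (here refl) P Py rewrite Py = refl
countBool-─ (x ∷ ys) (there y∈) P Py = trans (cong (_+_ (bit (P x))) (countBool-─ ys y∈ P Py)) (+-suc _ _)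

∈-─ : ∀ {y z : V} ys (y∈ : y ∈ ys) → z ∈ ys → ¬ z ≡ y → z ∈ (ys ─ y∈)
∈-─ (y ∷ ys) (here refl) (here refl) z≢y = contradiction refl z≢y
∈-─ (y ∷ ys) (here refl) (there z∈) z≢y = z∈
∈-─ (x ∷ ys) (there y∈) (here refl) z≢y = here refl
∈-─ (x ∷ ys) (there y∈) (there z∈) z≢y = there (∈-─ ys y∈ z∈ z≢y)

countBool-≥1 : ∀ {xs} (P : V → Bool) {v} → v ∈ xs → v ∈S P → 1 ≤ countBool xs P
countBool-≥1 {xs} P v∈ Pv rewrite countBool-─ xs v∈ P Pv = s≤s z≤n

countBool-≥2 : ∀ {xs} (P : V → Bool) {v w} → v ∈ xs → w ∈ xs → ¬ w ≡ v →
  v ∈S P → w ∈S P → 2 ≤ countBool xs P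
countBool-≥2 {xs} P v∈ w∈ w≢v Pv Pw
  rewrite countBool-─ xs v∈ P Pv | countBool-─ (xs ─ v∈) (∈-─ xs v∈ w∈ w≢v) P Pw = s≤s (s≤s z≤n)

countBool-≤-injection : (τ : V → V) {P Q : V → Bool} → (∀ {a b} → τ a ≡ τ b → a ≡ b) →
  ∀ {xs} ys → Unique xs → (∀ {x} → x ∈ xs → P x ≡ true → τ x ∈ ys × Q (τ x) ≡ true) →
  countBool xs P ≤ countBool ys Q
countBool-≤-injection τ inj ys [] maps = z≤n
countBool-≤-injection τ {P} {Q} inj {x ∷ xs} ys (x∉xs ∷ unique) maps with P x in Px
... | false = countBool-≤-injection τ inj ys unique (maps ∘ there)
... | true with maps (here refl) Px
... | τx∈ys , Qτx rewrite countBool-─ ys τx∈ys Q Qτx =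
  s≤s (countBool-≤-injection τ inj (ys ─ τx∈ys) unique maps′)
  where
  maps′ : ∀ {z} → z ∈ xs → P z ≡ true → τ z ∈ (ys ─ τx∈ys) × Q (τ z) ≡ true
  maps′ z∈xs Pz with maps (there z∈xs) Pz
  ... | τz∈ys , Qτz = ∈-─ ys τx∈ys τz∈ys (λ eq → All.lookup x∉xs z∈xs (sym (inj eq))) , Qτz

countBool-≤-sum : ∀ k xs (P : V → Bool) (Qs : List (V → Bool)) →
  (∀ u → k * bit (P u) ≤ sum (map (λ Q → bit (Q u)) Qs)) →
  k * countBool xs P ≤ sum (map (countBool xs) Qs)
countBool-≤-sum k [] P Qs pointwise = ≤-trans (≤-reflexive (*-zeroʳ k)) z≤n
countBool-≤-sum k (x ∷ xs) P Qs pointwise = begin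
  k * (bit (P x) + countBool xs P)                                    ≡⟨ *-distribˡ-+ k (bit (P x)) _ ⟩
  k * bit (P x) + k * countBool xs P                                  ≤⟨ +-mono-≤ (pointwise x) (countBool-≤-sum k xs P Qs pointwise) ⟩
  sum (map (λ Q → bit (Q x)) Qs) + sum (map (countBool xs) Qs)        ≡⟨ sum-map-+ Qs ⟨
  sum (map (countBool (x ∷ xs)) Qs)                                   ∎
  where
  open ≤-Reasoning
  sum-map-+ : ∀ Qs → sum (map (countBool (x ∷ xs)) Qs) ≡ sum (map (λ Q → bit (Q x)) Qs) + sum (map (countBool xs) Qs)
  sum-map-+ [] = refl
  sum-map-+ (Q ∷ Qs) = trans (cong (_+_ (bit (Q x) + countBool xs Q)) (sum-map-+ Qs)) (+-interchange (bit (Q x)) _ _ _)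

sum-map-≤ : ∀ {A : Set} (f : A → ℕ) xs {c} → (∀ {x} → x ∈ xs → f x ≤ c) → sum (map f xs) ≤ length xs * c
sum-map-≤ f [] bound = z≤n
sum-map-≤ f (x ∷ xs) bound = +-mono-≤ (bound (here refl)) (sum-map-≤ f xs (bound ∘ there))

-- Boxes and balls

∈-range⁺ : ∀ r {z} → ∣ z ∣ ≤ r → z ∈ range r
∈-range⁺ zero {+ zero} _ = here refl
∈-range⁺ (suc r) {+ n} ∣z∣≤ with n ℕ.≟ suc r
... | yes refl = here refl
... | no n≢ = there (there (∈-range⁺ r (≤-pred (≤∧≢⇒< ∣z∣≤ n≢))))
∈-range⁺ (suc r) { -[1+ n ]} ∣z∣≤ with n ℕ.≟ r
... | yes refl = there (here refl)
... | no n≢ = there (there (∈-range⁺ r (≤∧≢⇒< (≤-pred ∣z∣≤) n≢)))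

∈-range⁻ : ∀ r {z} → z ∈ range r → ∣ z ∣ ≤ r
∈-range⁻ zero (here refl) = z≤n
∈-range⁻ (suc r) (here refl) = ≤-refl
∈-range⁻ (suc r) (there (here refl)) = ≤-refl
∈-range⁻ (suc r) (there (there z∈)) = m≤n⇒m≤1+n (∈-range⁻ r z∈)

range-unique : ∀ r → Unique (range r)
range-unique zero = [] ∷ []
range-unique (suc r) =
  ((λ ()) ∷ All.tabulate (new refl)) ∷ All.tabulate (new refl) ∷ range-unique r
  where
  new : ∀ {z w} → ∣ z ∣ ≡ suc r → w ∈ range r → ¬ z ≡ w
  new ∣z∣≡ w∈ refl = <-irrefl ∣z∣≡ (s≤s (∈-range⁻ r w∈))

length-range : ∀ r → length (range r) ≡ suc (2 * r)
length-range zero = refl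
length-range (suc r) = cong (suc ∘ suc) (trans (length-range r) (sym (+-suc r (r + 0))))

length-cartesianProduct : ∀ {A B : Set} (xs : List A) (ys : List B) →
  length (cartesianProduct xs ys) ≡ length xs * length ys
length-cartesianProduct [] ys = refl
length-cartesianProduct (x ∷ xs) ys = begin
  length (map (x ,_) ys ++ cartesianProduct xs ys)         ≡⟨ length-++ (map (x ,_) ys) ⟩
  length (map (x ,_) ys) + length (cartesianProduct xs ys) ≡⟨ cong₂ _+_ (length-map (x ,_) ys) (length-cartesianProduct xs ys) ⟩
  length ys + length xs * length ys                        ∎
  where open ≡-Reasoning

box≡cartesianProduct : ∀ r → box r ≡ cartesianProduct (range r) (range r)
box≡cartesianProduct r = concatMap-pairs (range r)
  where
  concatMap-pairs : ∀ xs → concatMap (λ x → map (x ,_) (range r)) xs ≡ cartesianProduct xs (range r)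
  concatMap-pairs [] = refl
  concatMap-pairs (x ∷ xs) = cong (map (x ,_) (range r) ++_) (concatMap-pairs xs)

box-unique : ∀ r → Unique (box r)
box-unique r rewrite box≡cartesianProduct r = cartesianProduct⁺ (range-unique r) (range-unique r)

length-box : ∀ r → length (box r) ≡ suc (2 * r) * suc (2 * r)
length-box r rewrite box≡cartesianProduct r | length-cartesianProduct (range r) (range r) | length-range r = refl

InBox : ℕ → V → Set
InBox r (x , y) = ∣ x ∣ ≤ r × ∣ y ∣ ≤ r

∈-box⁺ : ∀ r {v} → InBox r v → v ∈ box r
∈-box⁺ r (∣x∣≤ , ∣y∣≤) rewrite box≡cartesianProduct r = ∈-cartesianProduct⁺ (∈-range⁺ r ∣x∣≤) (∈-range⁺ r ∣y∣≤)

∈-box⁻ : ∀ r {v} → v ∈ box r → InBox r v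
∈-box⁻ r v∈ rewrite box≡cartesianProduct r with ∈-cartesianProduct⁻ (range r) (range r) v∈
... | x∈ , y∈ = ∈-range⁻ r x∈ , ∈-range⁻ r y∈

any-≡true⁺ : ∀ {A : Set} (f : A → Bool) {xs x} → x ∈ xs → f x ≡ true → any f xs ≡ true
any-≡true⁺ f (here refl) fx rewrite fx = refl
any-≡true⁺ f {y ∷ xs} (there x∈) fx rewrite any-≡true⁺ f x∈ fx = ∨-zeroʳ (f y)

any-≡true⁻ : ∀ {A : Set} (f : A → Bool) xs → any f xs ≡ true → ∃ λ x → x ∈ xs × f x ≡ true
any-≡true⁻ f (y ∷ xs) any≡ with f y in fy
... | true = y , here refl , fy
... | false with any-≡true⁻ f xs any≡
... | x , x∈ , fx = x , there x∈ , fx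

inBall-suc : ∀ r {v} → v ∈S inBall r → v ∈S inBall (suc r)
inBall-suc r v∈ rewrite v∈ = refl

inBall-mono : ∀ {r r′} → r ≤ r′ → ∀ {v} → v ∈S inBall r → v ∈S inBall r′
inBall-mono {r} {r′} r≤r′ v∈ with ≤⇒≤′ r≤r′
... | ℕ.≤′-refl = v∈
... | ℕ.≤′-step {n} r≤′n = inBall-suc n (inBall-mono (≤′⇒≤ r≤′n) v∈)

inBall-step : ∀ r v {u} → Adj v u → u ∈S inBall r → v ∈S inBall (suc r)
inBall-step r v adj u∈ =
  trans (cong (inBall r v ∨_) (any-≡true⁺ (inBall r) adj u∈)) (∨-zeroʳ (inBall r v))

inBall-Adj : ∀ r {u w} → u ∈S inBall r → Adj u w → w ∈S inBall (suc r)
inBall-Adj r {u} {w} u∈ adj = inBall-step r w (Adj-sym u w adj) u∈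

∣x+d∣≤1+r : ∀ {r} x d → ∣ d ∣ ≤ 1 → ∣ x ∣ ≤ r → ∣ x ℤ.+ d ∣ ≤ suc r
∣x+d∣≤1+r {r} x d ∣d∣≤1 ∣x∣≤r =
  ≤-trans (ℤP.∣i+j∣≤∣i∣+∣j∣ x d) (≤-trans (+-mono-≤ ∣x∣≤r ∣d∣≤1) (≤-reflexive (+-comm r 1)))

InBox-Adj : ∀ {r w v} → InBox r w → Adj w v → InBox (suc r) v
InBox-Adj {w = x , y} (∣x∣≤ , ∣y∣≤) east-adj = ∣x+d∣≤1+r x 1ℤ ≤-refl ∣x∣≤ , m≤n⇒m≤1+n ∣y∣≤
InBox-Adj {w = x , y} (∣x∣≤ , ∣y∣≤) west-adj = ∣x+d∣≤1+r x (ℤ.- 1ℤ) ≤-refl ∣x∣≤ , m≤n⇒m≤1+n ∣y∣≤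
InBox-Adj {w = x , y} (∣x∣≤ , ∣y∣≤) vert-adj with isEven (x ℤ.+ y)
... | true = m≤n⇒m≤1+n ∣x∣≤ , ∣x+d∣≤1+r y 1ℤ ≤-refl ∣y∣≤
... | false = m≤n⇒m≤1+n ∣x∣≤ , ∣x+d∣≤1+r y (ℤ.- 1ℤ) ≤-refl ∣y∣≤

inBall⇒InBox : ∀ r v → v ∈S inBall r → InBox r v
inBall⇒InBox zero v v∈ with v ≟V origin
inBall⇒InBox zero v v∈ | yes refl = z≤n , z≤n
inBall⇒InBox zero v () | no _
inBall⇒InBox (suc r) v v∈ with inBall r v in v∈r
... | true = let (∣x∣≤ , ∣y∣≤) = inBall⇒InBox r v v∈r in m≤n⇒m≤1+n ∣x∣≤ , m≤n⇒m≤1+n ∣y∣≤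
... | false with any-≡true⁻ (inBall r) (nbrs v) v∈
... | w , adj , w∈r = InBox-Adj (inBall⇒InBox r w w∈r) (Adj-sym v w adj)

inBall⇒∈box : ∀ r {v} → v ∈S inBall r → v ∈ box r
inBall⇒∈box r {v} = ∈-box⁺ r ∘ inBall⇒InBox r v

ballSize-≤ : ∀ r → ballSize r ≤ suc (2 * r) * suc (2 * r)
ballSize-≤ r = ≤-trans (countBool-≤-length (box r) (inBall r)) (≤-reflexive (length-box r))

inBall-origin : origin ∈S inBall 0
inBall-origin with origin ≟V origin
... | yes _ = refl
... | no o≢o = contradiction refl o≢o

inBall-axis : ∀ x → (x , 0ℤ) ∈S inBall ∣ x ∣
inBall-axis (+ zero) = inBall-origin
inBall-axis (+ suc n) = inBall-step n (+ suc n , 0ℤ) west-adj (inBall-axis (+ n))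
inBall-axis -[1+ zero ] = inBall-step 0 (-[1+ 0 ] , 0ℤ) east-adj inBall-origin
inBall-axis -[1+ suc n ] = inBall-step (suc n) (-[1+ suc n ] , 0ℤ) east-adj (inBall-axis -[1+ n ])

west-vert-east : ∀ x y → west (vert (east (x , y))) ≡ (x , (if isEven (x ℤ.+ y) then y ℤ.- 1ℤ else y ℤ.+ 1ℤ))
west-vert-east x y rewrite isEven-east x y =
  cong₂ _,_ (z+1-1≡z x) (if-not (isEven (x ℤ.+ y)))
  where
  if-not : ∀ b → (if not b then y ℤ.+ 1ℤ else y ℤ.- 1ℤ) ≡ (if b then y ℤ.- 1ℤ else y ℤ.+ 1ℤ)
  if-not true = refl
  if-not false = refl

inBall-vertical : ∀ r x y → (x , y) ∈S inBall r →
  (x , y ℤ.+ 1ℤ) ∈S inBall (3 + r) × (x , y ℤ.- 1ℤ) ∈S inBall (3 + r)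
inBall-vertical r x y v∈ =
  both (isEven (x ℤ.+ y)) direct (subst (_∈S inBall (3 + r)) (west-vert-east x y) around)
  where
  direct : vert (x , y) ∈S inBall (3 + r)
  direct = inBall-mono (m≤n+m (suc r) 2) (inBall-Adj r v∈ vert-adj)
  around : west (vert (east (x , y))) ∈S inBall (3 + r)
  around = inBall-Adj (2 + r) (inBall-Adj (suc r) (inBall-Adj r v∈ east-adj) vert-adj) west-adj
  both : ∀ b → (x , (if b then y ℤ.+ 1ℤ else y ℤ.- 1ℤ)) ∈S inBall (3 + r) →
    (x , (if b then y ℤ.- 1ℤ else y ℤ.+ 1ℤ)) ∈S inBall (3 + r) →
    (x , y ℤ.+ 1ℤ) ∈S inBall (3 + r) × (x , y ℤ.- 1ℤ) ∈S inBall (3 + r)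
  both true up down = up , down
  both false down up = up , down

3+[a+3n]≡a+3[1+n] : ∀ a n → 3 + (a + 3 * n) ≡ a + 3 * suc n
3+[a+3n]≡a+3[1+n] = ℕSolver.solve-∀

inBall-∣x∣+3∣y∣ : ∀ x y → (x , y) ∈S inBall (∣ x ∣ + 3 * ∣ y ∣)
inBall-∣x∣+3∣y∣ x (+ zero) = subst (λ r → (x , 0ℤ) ∈S inBall r) (sym (+-identityʳ ∣ x ∣)) (inBall-axis x)
inBall-∣x∣+3∣y∣ x (+ suc n) =
  subst₂ (λ r y → (x , y) ∈S inBall r) (3+[a+3n]≡a+3[1+n] ∣ x ∣ n) (trans (sym (ℤP.pos-+ n 1)) (cong +_ (+-comm n 1)))
    (proj₁ (inBall-vertical (∣ x ∣ + 3 * n) x (+ n) (inBall-∣x∣+3∣y∣ x (+ n))))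
inBall-∣x∣+3∣y∣ x -[1+ zero ] =
  subst (λ r → (x , -[1+ 0 ]) ∈S inBall r) (3+[a+3n]≡a+3[1+n] ∣ x ∣ 0)
    (proj₂ (inBall-vertical (∣ x ∣ + 3 * 0) x 0ℤ (inBall-∣x∣+3∣y∣ x 0ℤ)))
inBall-∣x∣+3∣y∣ x -[1+ suc n ] =
  subst₂ (λ r y → (x , y) ∈S inBall r) (3+[a+3n]≡a+3[1+n] ∣ x ∣ (suc n)) (cong (λ k → -[1+ suc k ]) (+-identityʳ n))
    (proj₂ (inBall-vertical (∣ x ∣ + 3 * suc n) x -[1+ n ] (inBall-∣x∣+3∣y∣ x -[1+ n ])))

box⊆ball : ∀ {m r} → 4 * m ≤ r → ∀ {v} → v ∈ box m → v ∈S inBall r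
box⊆ball {m} 4m≤r {x , y} v∈ with ∈-box⁻ m v∈
... | ∣x∣≤m , ∣y∣≤m = inBall-mono (≤-trans (+-mono-≤ ∣x∣≤m (*-monoʳ-≤ 3 ∣y∣≤m)) 4m≤r) (inBall-∣x∣+3∣y∣ x y)

ballSize-≥ : ∀ {m r} → 4 * m ≤ r → suc (2 * m) * suc (2 * m) ≤ ballSize r
ballSize-≥ {m} {r} 4m≤r =
  subst (_≤ ballSize r) (trans (countBool-const-true (box m)) (length-box m))
    (countBool-≤-injection id {P = λ _ → true} {Q = inBall r} id (box r) (box-unique m)
      (λ v∈ _ → inBall⇒∈box r (box⊆ball {m} 4m≤r v∈) , box⊆ball {m} 4m≤r v∈))

ballCount≤ballSize : ∀ S r → ballCount S r ≤ ballSize r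
ballCount≤ballSize S r = countBool-mono (box r) λ {v} → ∧-conicalˡ (inBall r v) (S v)

ballSize-pos : ∀ r → 1 ≤ ballSize r
ballSize-pos r = ballSize-≥ {0} {r} z≤n

-- Closed neighbourhoods of a RED:LD set

remove-self : ∀ S u → remove S u u ≡ false
remove-self S u with u ≟V u
... | yes _ = ∧-zeroʳ (S u)
... | no u≢u = contradiction refl u≢u

remove⊆ : ∀ S {v w} → w ∈S remove S v → w ∈S S
remove⊆ S {v} {w} w∈ with S w
... | true = refl
... | false = w∈

remove-≢ : ∀ S {v w} → w ∈S remove S v → ¬ w ≡ v
remove-≢ S {v} w∈ refl = not-¬ (remove-self S v) w∈

closedNbhd-≥2 : ∀ S → IsRedLD S → ∀ u → 2 ≤ countBool (u ∷ nbrs u) S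
closedNbhd-≥2 S ((dominating , _) , redundant) u with S u in Su
... | true with proj₁ (redundant u Su) u (not-¬ (remove-self S u))
... | w , adj , w∈ = s≤s (countBool-≥1 S adj (remove⊆ S w∈))
closedNbhd-≥2 S ((dominating , _) , redundant) u | false with dominating u (not-¬ Su)
... | w₁ , adj₁ , w₁∈ with proj₁ (redundant w₁ w₁∈) u (not-¬ Su ∘ remove⊆ S)
... | w₂ , adj₂ , w₂∈ = countBool-≥2 S adj₁ adj₂ (remove-≢ S w₂∈) w₁∈ (remove⊆ S w₂∈)

moves : List (V → V)
moves = id ∷ east ∷ west ∷ vert ∷ []

moves-injective : ∀ {τ} → τ ∈ moves → ∀ {a b} → τ a ≡ τ b → a ≡ b
moves-injective (here refl) = id
moves-injective (there (here refl)) = injective-by east west west-east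
moves-injective (there (there (here refl))) = injective-by west east east-west
moves-injective (there (there (there (here refl)))) = injective-by vert vert vert-involutive

moves-inBall : ∀ {τ} → τ ∈ moves → ∀ r {u} → u ∈S inBall r → τ u ∈S inBall (suc r)
moves-inBall (here refl) r u∈ = inBall-suc r u∈
moves-inBall (there (here refl)) r u∈ = inBall-Adj r u∈ east-adj
moves-inBall (there (there (here refl))) r u∈ = inBall-Adj r u∈ west-adj
moves-inBall (there (there (there (here refl)))) r u∈ = inBall-Adj r u∈ vert-adj

-- Each u ∈ B_r sees two detectors in N[u], which is definitionally map (_$ u) moves, and each
-- detector of B_{r+1} is seen at most |moves| = 4 times.
ballSize≤2*ballCount : ∀ S → IsRedLD S → ∀ r → ballSize r ≤ 2 * ballCount S (suc r)
ballSize≤2*ballCount S redLD r = *-cancelˡ-≤ 2 (begin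
  2 * ballSize r                                    ≤⟨ countBool-≤-sum 2 (box r) (inBall r) seen pointwise ⟩
  sum (map (countBool (box r)) seen)                ≤⟨ sum-map-≤ (λ τ → countBool (box r) (seenBy τ)) moves each ⟩
  4 * ballCount S (suc r)                           ≡⟨ *-assoc 2 2 (ballCount S (suc r)) ⟩
  2 * (2 * ballCount S (suc r))                     ∎)
  where
  open ≤-Reasoning
  seenBy : (V → V) → V → Bool
  seenBy τ u = inBall r u ∧ S (τ u)
  seen : List (V → Bool)
  seen = map seenBy moves
  pointwise : ∀ u → 2 * bit (inBall r u) ≤ sum (map (λ Q → bit (Q u)) seen)
  pointwise u with inBall r u
  ... | false = z≤n
  ... | true = closedNbhd-≥2 S redLD u
  each : ∀ {τ} → τ ∈ moves → countBool (box r) (seenBy τ) ≤ ballCount S (suc r)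
  each {τ} τ∈ =
    countBool-≤-injection τ {Q = λ v → inBall (suc r) v ∧ S v} (moves-injective τ∈) (box (suc r)) (box-unique r) maps
    where
    maps : ∀ {u} → u ∈ box r → seenBy τ u ≡ true → τ u ∈ box (suc r) × inBall (suc r) (τ u) ∧ S (τ u) ≡ true
    maps {u} _ u-seen = inBall⇒∈box (suc r) τu∈ , cong₂ _∧_ τu∈ (∧-conicalʳ (inBall r u) (S (τ u)) u-seen)
      where
      τu∈ : τ u ∈S inBall (suc r)
      τu∈ = moves-inBall τ∈ r (∧-conicalˡ (inBall r u) (S (τ u)) u-seen)

-- Growth of the ball sizes

n<2^n : ∀ n → n < 2 ^ n
n<2^n zero = s≤s z≤n
n<2^n (suc n) = ≤-trans (+-mono-≤ (≤-trans (s≤s z≤n) (n<2^n n)) (n<2^n n))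
  (≤-reflexive (cong (_+_ (2 ^ n)) (sym (+-identityʳ (2 ^ n)))))

-- With p = 2a + 1 + 8b and m = 4p: 2(a + m b) + 1 ≤ p² < 4^p.  The witness is kept opaque
-- so that the type checker never unfolds 2 ^ m.
opaque
  exponential-beats-quadratic : ∀ a b → ∃ λ m → suc (2 * (a + m * b)) * suc (2 * (a + m * b)) < 2 ^ m
  exponential-beats-quadratic a b = 4 * p , (begin-strict
    X * X                         <⟨ *-mono-< X<4^p X<4^p ⟩
    2 ^ (2 * p) * 2 ^ (2 * p)     ≡⟨ ^-distribˡ-+-* 2 (2 * p) (2 * p) ⟨
    2 ^ (2 * p + 2 * p)           ≡⟨ cong (2 ^_) (double-double p) ⟩
    2 ^ (4 * p)                   ∎)
    where
    open ≤-Reasoning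
    p : ℕ
    p = suc (2 * a) + 8 * b
    X : ℕ
    X = suc (2 * (a + 4 * p * b))
    X≤p*p : X ≤ p * p
    X≤p*p = begin
      X                             ≡⟨ split a b p ⟩
      suc (2 * a) + 8 * b * p       ≤⟨ +-monoˡ-≤ (8 * b * p) (m≤n*m (suc (2 * a)) p) ⟩
      p * suc (2 * a) + 8 * b * p   ≡⟨ factor p (suc (2 * a)) b ⟩
      p * p                         ∎
      where
      split : ∀ a b p → suc (2 * (a + 4 * p * b)) ≡ suc (2 * a) + 8 * b * p
      split = ℕSolver.solve-∀
      factor : ∀ p c b → p * c + 8 * b * p ≡ p * (c + 8 * b)
      factor = ℕSolver.solve-∀
    p*p<4^p : p * p < 2 ^ (2 * p)
    p*p<4^p = begin-strict
      p * p               <⟨ *-mono-< (n<2^n p) (n<2^n p) ⟩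
      2 ^ p * 2 ^ p       ≡⟨ ^-distribˡ-+-* 2 p p ⟨
      2 ^ (p + p)         ≡⟨ cong (2 ^_) (cong (_+_ p) (sym (+-identityʳ p))) ⟩
      2 ^ (2 * p)         ∎
    X<4^p : X < 2 ^ (2 * p)
    X<4^p = ≤-<-trans X≤p*p p*p<4^p
    double-double : ∀ p → 2 * p + 2 * p ≡ 4 * p
    double-double = ℕSolver.solve-∀

module _ (f : ℕ → ℕ) (k : ℕ) where

  SlowStep : ℕ → Set
  SlowStep r = suc k * f (suc r) ≤ suc (suc k) * f r

  SlowStepFrom : ℕ → Set
  SlowStepFrom t = ∃ λ r → t ≤ r × SlowStep r

  -- Each failure of SlowStep adds at least f t to suc k * f, so suc k failures double f.
  linear-or-slow : ∀ t j → SlowStepFrom t ⊎ suc k * f t + j * f t ≤ suc k * f (t + j)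
  linear-or-slow t zero = inj₂ (≤-reflexive (trans (+-identityʳ _) (cong (λ r → suc k * f r) (sym (+-identityʳ t)))))
  linear-or-slow t (suc j) with linear-or-slow t j
  ... | inj₁ slow = inj₁ slow
  ... | inj₂ gain with suc k * f (suc (t + j)) ≤? suc (suc k) * f (t + j)
  ... | yes slow = inj₁ (t + j , m≤m+n t j , slow)
  ... | no fast = inj₂ (begin
    suc k * f t + suc j * f t             ≡⟨ shuffle (suc k * f t) (f t) (j * f t) ⟩
    (suc k * f t + j * f t) + f t         ≤⟨ +-mono-≤ gain ft≤ ⟩
    suc k * f (t + j) + f (t + j)         ≡⟨ +-comm (suc k * f (t + j)) (f (t + j)) ⟩
    suc (suc k) * f (t + j)               ≤⟨ <⇒≤ (≰⇒> fast) ⟩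
    suc k * f (suc (t + j))               ≡⟨ cong (λ r → suc k * f r) (sym (+-suc t j)) ⟩
    suc k * f (t + suc j)                 ∎)
    where
    open ≤-Reasoning
    shuffle : ∀ a b c → a + (b + c) ≡ (a + c) + b
    shuffle = ℕSolver.solve-∀
    ft≤ : f t ≤ f (t + j)
    ft≤ = *-cancelˡ-≤ (suc k) (≤-trans (m≤m+n (suc k * f t) (j * f t)) gain)

  doubling-or-slow : ∀ t → SlowStepFrom t ⊎ 2 * f t ≤ f (t + suc k)
  doubling-or-slow t with linear-or-slow t (suc k)
  ... | inj₁ slow = inj₁ slow
  ... | inj₂ gain = inj₂ (*-cancelˡ-≤ (suc k) (≤-trans (≤-reflexive (twice (suc k) (f t))) gain))
    where
    twice : ∀ a b → a * (2 * b) ≡ a * b + a * b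
    twice = ℕSolver.solve-∀

  exponential-or-slow : ∀ m t → SlowStepFrom t ⊎ 2 ^ m * f t ≤ f (t + m * suc k)
  exponential-or-slow zero t = inj₂ (≤-reflexive (trans (+-identityʳ (f t)) (cong f (sym (+-identityʳ t)))))
  exponential-or-slow (suc m) t with doubling-or-slow t
  ... | inj₁ slow = inj₁ slow
  ... | inj₂ double with exponential-or-slow m (t + suc k)
  ... | inj₁ (r , t+k≤r , slow) = inj₁ (r , ≤-trans (m≤m+n t (suc k)) t+k≤r , slow)
  ... | inj₂ growth = inj₂ (begin
    2 * 2 ^ m * f t               ≡⟨ *-comm-middle 2 (2 ^ m) (f t) ⟩
    2 ^ m * (2 * f t)             ≤⟨ *-monoʳ-≤ (2 ^ m) double ⟩
    2 ^ m * f (t + suc k)         ≤⟨ growth ⟩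
    f (t + suc k + m * suc k)     ≡⟨ cong f (+-assoc t (suc k) (m * suc k)) ⟩
    f (t + suc m * suc k)         ∎)
    where
    open ≤-Reasoning
    *-comm-middle : ∀ a b c → a * b * c ≡ b * (a * c)
    *-comm-middle = ℕSolver.solve-∀

  slowStep-unbounded : (∀ r → 1 ≤ f r) → (∀ r → f r ≤ suc (2 * r) * suc (2 * r)) →
    ∀ R → ∃ λ r → R ≤ r × SlowStep r
  slowStep-unbounded f-pos f-quadratic R with exponential-beats-quadratic R (suc k)
  ... | m , quadratic<2^m with exponential-or-slow m R
  ... | inj₁ slow = slow
  ... | inj₂ growth = contradiction (begin
    2 ^ m                         ≡⟨ *-identityʳ (2 ^ m) ⟨
    2 ^ m * 1                     ≤⟨ *-monoʳ-≤ (2 ^ m) (f-pos R) ⟩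
    2 ^ m * f R                   ≤⟨ growth ⟩
    f (R + m * suc k)             ≤⟨ f-quadratic (R + m * suc k) ⟩
    _                             ∎) (<⇒≱ quadratic<2^m)
    where open ≤-Reasoning

-- The column construction

detectorColumn : ℤ → Bool
detectorColumn (+ zero) = true
detectorColumn (+ suc n) = isEven (+ n)
detectorColumn -[1+ n ] = not (isEven (+ n))

columns : VSet
columns (x , _) = detectorColumn x

data IsUnit : ℤ → Set where
  unit⁺ : IsUnit 1ℤ
  unit⁻ : IsUnit -1ℤ

gap-neighbour : ∀ x {δ} → detectorColumn x ≡ false → IsUnit δ → detectorColumn (x ℤ.+ δ) ≡ true
gap-neighbour (+ suc n) gap unit⁺ rewrite +-comm n 1 = trans (isEven-+suc n) (cong not gap)
gap-neighbour -[1+ zero ] gap unit⁺ = refl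
gap-neighbour -[1+ suc n ] gap unit⁺ = trans (sym (isEven-+suc n)) (not-injective {y = true} gap)
gap-neighbour (+ suc zero) gap unit⁻ = refl
gap-neighbour (+ suc (suc n)) gap unit⁻ = not-injective {y = true} (trans (sym (isEven-+suc n)) gap)
gap-neighbour -[1+ n ] gap unit⁻ rewrite +-identityʳ n = cong not (trans (isEven-+suc n) gap)

mirror-detectors : ∀ x → detectorColumn x ≡ true → detectorColumn (ℤ.- x) ≡ true → x ≡ 0ℤ
mirror-detectors (+ zero) _ _ = refl
mirror-detectors (+ suc n) x∈ -x∈ = contradiction (trans (sym (cong not x∈)) -x∈) λ ()
mirror-detectors -[1+ n ] x∈ -x∈ = contradiction (trans (sym (cong not -x∈)) x∈) λ ()

IsUnit-neg : ∀ {δ} → IsUnit δ → IsUnit (ℤ.- δ)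
IsUnit-neg unit⁺ = unit⁻
IsUnit-neg unit⁻ = unit⁺

shift : ℤ → V → V
shift a (x , y) = (x ℤ.+ a , y)

shift-Adj : ∀ {δ} → IsUnit δ → ∀ u → Adj u (shift δ u)
shift-Adj unit⁺ u = east-adj
shift-Adj unit⁻ u = west-adj

shift-injective : ∀ a {u v} → shift a u ≡ shift a v → u ≡ v
shift-injective a {x , y} {x′ , y′} eq = cong₂ _,_ (+-cancelʳ a x x′ (cong proj₁ eq)) (cong proj₂ eq)

Δ : V → V → ℤ
Δ p q = proj₁ q ℤ.- proj₁ p

Δ-trans : ∀ p q r → Δ p r ≡ Δ p q ℤ.+ Δ q r
Δ-trans (x , _) (x′ , _) (x″ , _) = telescope x x′ x″
  where
  telescope : ∀ x x′ x″ → x″ ℤ.- x ≡ (x′ ℤ.- x) ℤ.+ (x″ ℤ.- x′)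
  telescope = ℤSolver.solve-∀

Δ-shift : ∀ a u → Δ u (shift a u) ≡ a
Δ-shift a (x , _) = cancel x a
  where
  cancel : ∀ x a → (x ℤ.+ a) ℤ.- x ≡ a
  cancel = ℤSolver.solve-∀

Δ-shift˘ : ∀ a u → Δ (shift a u) u ≡ ℤ.- a
Δ-shift˘ a (x , _) = cancel x a
  where
  cancel : ∀ x a → x ℤ.- (x ℤ.+ a) ≡ ℤ.- a
  cancel = ℤSolver.solve-∀

Δ-sym : ∀ p q → Δ q p ≡ ℤ.- Δ p q
Δ-sym (x , _) (x′ , _) = flip x x′
  where
  flip : ∀ x x′ → x ℤ.- x′ ≡ ℤ.- (x′ ℤ.- x)
  flip = ℤSolver.solve-∀

Δ-vert˘ : ∀ v → Δ (vert v) v ≡ 0ℤ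
Δ-vert˘ (x , _) = ℤP.+-inverseʳ x

Adj⇒∣Δ∣≤1 : ∀ {p q} → Adj p q → ∣ Δ p q ∣ ≤ 1
Adj⇒∣Δ∣≤1 {p} east-adj = subst (λ k → ∣ k ∣ ≤ 1) (sym (Δ-shift 1ℤ p)) ≤-refl
Adj⇒∣Δ∣≤1 {p} west-adj = subst (λ k → ∣ k ∣ ≤ 1) (sym (Δ-shift -1ℤ p)) ≤-refl
Adj⇒∣Δ∣≤1 {x , _} vert-adj = subst (λ k → ∣ k ∣ ≤ 1) (sym (ℤP.+-inverseʳ x)) z≤n

Δ-meet : ∀ {u v δ} → shift δ u ≡ shift (ℤ.- δ) v → Δ u v ≡ δ ℤ.+ δ
Δ-meet {u} {v} {δ} meet = begin
  Δ u v                                   ≡⟨ Δ-trans u (shift δ u) v ⟩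
  Δ u (shift δ u) ℤ.+ Δ (shift δ u) v     ≡⟨ cong₂ ℤ._+_ (Δ-shift δ u) (cong (λ w → Δ w v) meet) ⟩
  δ ℤ.+ Δ (shift (ℤ.- δ) v) v             ≡⟨ cong (ℤ._+_ δ) (trans (Δ-shift˘ (ℤ.- δ) v) (ℤP.neg-involutive δ)) ⟩
  δ ℤ.+ δ                                 ∎
  where open ≡-Reasoning

twice-far : ∀ {δ} → IsUnit δ → ¬ ∣ δ ℤ.+ δ ∣ ≤ 1
twice-far unit⁺ (s≤s ())
twice-far unit⁻ (s≤s ())

thrice-far : ∀ {δ} → IsUnit δ → ¬ ∣ δ ℤ.+ δ ℤ.+ δ ∣ ≤ 1
thrice-far unit⁺ (s≤s ())
thrice-far unit⁻ (s≤s ())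

neg≢ : ∀ {δ} → IsUnit δ → ¬ ℤ.- δ ≡ δ
neg≢ unit⁺ ()
neg≢ unit⁻ ()

thrice≢neg : ∀ {δ} → IsUnit δ → ¬ ℤ.- δ ≡ δ ℤ.+ δ ℤ.+ δ
thrice≢neg unit⁺ ()
thrice≢neg unit⁻ ()

gap-shift : ∀ u {δ} → ¬ u ∈S columns → IsUnit δ → shift δ u ∈S columns
gap-shift (x , _) u∉ = gap-neighbour x (¬-not {y = true} u∉)

detector-neighbour : ∀ {u w} → ¬ u ∈S columns → Adj u w → w ∈S columns → ∃ λ δ → IsUnit δ × w ≡ shift δ u
detector-neighbour u∉ east-adj _ = 1ℤ , unit⁺ , refl
detector-neighbour u∉ west-adj _ = -1ℤ , unit⁻ , refl
detector-neighbour u∉ vert-adj w∈ = contradiction w∈ u∉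

module _ (d : V) where

  private
    T : VSet
    T = remove columns d

  SameTrace : V → V → Set
  SameTrace u v = ∀ w → Adj u w → w ∈S T → Adj v w

  detector∈T : ∀ {w} → w ∈S columns → ¬ w ≡ d → w ∈S T
  detector∈T {w} w∈ w≢d with w ≟V d
  ... | yes w≡d = contradiction w≡d w≢d
  ... | no _ rewrite w∈ = refl

  ∉T : ∀ {u} → ¬ u ∈S T → ¬ u ∈S columns ⊎ (u ∈S columns × u ≡ d)
  ∉T {u} u∉T = classify (columns u) refl (u ≟V d)
    where
    classify : ∀ b → columns u ≡ b → Dec (u ≡ d) → ¬ u ∈S columns ⊎ (u ∈S columns × u ≡ d)
    classify false u∉ _ = inj₁ (not-¬ u∉)
    classify true u∈ (yes u≡d) = inj₂ (u∈ , u≡d)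
    classify true u∈ (no u≢d) = contradiction (detector∈T u∈ u≢d) u∉T

  gap-detector∈T : ∀ u → ¬ u ∈S columns → ∃ λ δ → IsUnit δ × shift δ u ∈S T
  gap-detector∈T u u∉ with shift 1ℤ u ≟V d
  ... | no east≢d = 1ℤ , unit⁺ , detector∈T (gap-shift u u∉ unit⁺) east≢d
  ... | yes east≡d = -1ℤ , unit⁻ , detector∈T (gap-shift u u∉ unit⁻) west≢d
    where
    west≢d : ¬ shift -1ℤ u ≡ d
    west≢d west≡d = contradiction
      (trans (sym (Δ-shift 1ℤ u)) (trans (cong (Δ u) (trans east≡d (sym west≡d))) (Δ-shift -1ℤ u))) λ ()

  T-dominating : ∀ u → ¬ u ∈S T → ∃ λ w → Adj u w × w ∈S T
  T-dominating u u∉T with ∉T u∉T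
  ... | inj₁ u∉ = let (δ , δ-unit , w∈T) = gap-detector∈T u u∉ in shift δ u , shift-Adj δ-unit u , w∈T
  ... | inj₂ (u∈ , u≡d) = vert u , vert-adj , detector∈T u∈ (λ vert≡d → vert-≢ u (trans vert≡d (sym u≡d)))

  -- If shift δ u = shift (-δ) v, then v lies 2δ from u, and the outer detectors of u and v
  -- (at -δ and 3δ from u) are too far from v, resp. u, while one of them survives in T.
  opposite-gaps : ∀ {u v δ} → IsUnit δ → ¬ u ∈S columns → ¬ v ∈S columns →
    shift δ u ≡ shift (ℤ.- δ) v → SameTrace u v → SameTrace v u → ⊥
  opposite-gaps {u} {v} {δ} δ-unit u∉ v∉ meet u→v v→u with shift (ℤ.- δ) u ≟V d
  ... | no u′≢d = thrice-far δ-unit (subst (_≤ 1) ∣Δvu′∣ (Adj⇒∣Δ∣≤1 v-u′))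
    where
    v-u′ : Adj v (shift (ℤ.- δ) u)
    v-u′ = u→v _ (shift-Adj (IsUnit-neg δ-unit) u) (detector∈T (gap-shift u u∉ (IsUnit-neg δ-unit)) u′≢d)
    ∣Δvu′∣ : ∣ Δ v (shift (ℤ.- δ) u) ∣ ≡ ∣ δ ℤ.+ δ ℤ.+ δ ∣
    ∣Δvu′∣ = begin
      ∣ Δ v (shift (ℤ.- δ) u) ∣                                ≡⟨ cong ∣_∣ (Δ-trans v u (shift (ℤ.- δ) u)) ⟩
      ∣ Δ v u ℤ.+ Δ u (shift (ℤ.- δ) u) ∣                      ≡⟨ cong₂ (λ a b → ∣ a ℤ.+ b ∣) Δvu (Δ-shift (ℤ.- δ) u) ⟩
      ∣ ℤ.- (δ ℤ.+ δ) ℤ.+ ℤ.- δ ∣                              ≡⟨ cong ∣_∣ (negate δ) ⟩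
      ∣ ℤ.- (δ ℤ.+ δ ℤ.+ δ) ∣                                  ≡⟨ ℤP.∣-i∣≡∣i∣ (δ ℤ.+ δ ℤ.+ δ) ⟩
      ∣ δ ℤ.+ δ ℤ.+ δ ∣                                        ∎
      where
      open ≡-Reasoning
      Δvu : Δ v u ≡ ℤ.- (δ ℤ.+ δ)
      Δvu = trans (Δ-sym u v) (cong ℤ.-_ (Δ-meet {u} {v} {δ} meet))
      negate : ∀ δ → ℤ.- (δ ℤ.+ δ) ℤ.+ ℤ.- δ ≡ ℤ.- (δ ℤ.+ δ ℤ.+ δ)
      negate = ℤSolver.solve-∀
  ... | yes u′≡d = thrice-far δ-unit (subst (_≤ 1) ∣Δuv′∣ (Adj⇒∣Δ∣≤1 u-v′))
    where
    Δuv′ : Δ u (shift δ v) ≡ δ ℤ.+ δ ℤ.+ δ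
    Δuv′ = trans (Δ-trans u v (shift δ v)) (cong₂ ℤ._+_ (Δ-meet {u} {v} {δ} meet) (Δ-shift δ v))
    v′≢d : ¬ shift δ v ≡ d
    v′≢d v′≡d = thrice≢neg δ-unit (trans (sym (Δ-shift (ℤ.- δ) u)) (trans (cong (Δ u) (trans u′≡d (sym v′≡d))) Δuv′))
    u-v′ : Adj u (shift δ v)
    u-v′ = v→u _ (shift-Adj δ-unit v) (detector∈T (gap-shift v v∉ δ-unit) v′≢d)
    ∣Δuv′∣ : ∣ Δ u (shift δ v) ∣ ≡ ∣ δ ℤ.+ δ ℤ.+ δ ∣
    ∣Δuv′∣ = cong ∣_∣ Δuv′

  gaps-separated : ∀ {u v} → ¬ u ∈S columns → ¬ v ∈S columns → SameTrace u v → SameTrace v u → u ≡ v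
  gaps-separated {u} {v} u∉ v∉ u→v v→u with gap-detector∈T u u∉
  ... | δ , δ-unit , w∈T with detector-neighbour v∉ (u→v (shift δ u) (shift-Adj δ-unit u) w∈T) (remove⊆ columns {d} {shift δ u} w∈T)
  ... | ε , ε-unit , meet with δ-unit | ε-unit
  ... | unit⁺ | unit⁺ = shift-injective 1ℤ meet
  ... | unit⁻ | unit⁻ = shift-injective -1ℤ meet
  ... | unit⁺ | unit⁻ = ⊥-elim (opposite-gaps unit⁺ u∉ v∉ meet u→v v→u)
  ... | unit⁻ | unit⁺ = ⊥-elim (opposite-gaps unit⁻ u∉ v∉ meet u→v v→u)

  -- vert d survives in T, so it is a detector neighbour of the gap vertex u, at δ from u;
  -- then the other neighbour of u, at -δ, is a detector of T at distance 2 from d.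
  gap-vs-removed : ∀ {u v} → ¬ u ∈S columns → v ∈S columns → v ≡ d → SameTrace u v → SameTrace v u → ⊥
  gap-vs-removed {u} u∉ d∈ refl u→d d→u
    with detector-neighbour u∉ (d→u (vert d) vert-adj (detector∈T d∈ (vert-≢ d))) d∈
  ... | δ , δ-unit , vert≡ = twice-far δ-unit (subst (_≤ 1) ∣Δdu′∣ (Adj⇒∣Δ∣≤1 d-u′))
    where
    Δud : Δ u d ≡ δ
    Δud = begin
      Δ u d                              ≡⟨ Δ-trans u (vert d) d ⟩
      Δ u (vert d) ℤ.+ Δ (vert d) d      ≡⟨ cong₂ ℤ._+_ (trans (cong (Δ u) vert≡) (Δ-shift δ u)) (Δ-vert˘ d) ⟩
      δ ℤ.+ 0ℤ                           ≡⟨ ℤP.+-identityʳ δ ⟩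
      δ                                  ∎
      where open ≡-Reasoning
    u′≢d : ¬ shift (ℤ.- δ) u ≡ d
    u′≢d u′≡d = neg≢ δ-unit (trans (sym (Δ-shift (ℤ.- δ) u)) (trans (cong (Δ u) u′≡d) Δud))
    d-u′ : Adj d (shift (ℤ.- δ) u)
    d-u′ = u→d _ (shift-Adj (IsUnit-neg δ-unit) u) (detector∈T (gap-shift u u∉ (IsUnit-neg δ-unit)) u′≢d)
    ∣Δdu′∣ : ∣ Δ d (shift (ℤ.- δ) u) ∣ ≡ ∣ δ ℤ.+ δ ∣
    ∣Δdu′∣ = begin
      ∣ Δ d (shift (ℤ.- δ) u) ∣                    ≡⟨ cong ∣_∣ (Δ-trans d u (shift (ℤ.- δ) u)) ⟩
      ∣ Δ d u ℤ.+ Δ u (shift (ℤ.- δ) u) ∣          ≡⟨ cong₂ (λ a b → ∣ a ℤ.+ b ∣) (trans (Δ-sym u d) (cong ℤ.-_ Δud))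
                                                                                       (Δ-shift (ℤ.- δ) u) ⟩
      ∣ ℤ.- δ ℤ.+ ℤ.- δ ∣                          ≡⟨ cong ∣_∣ (ℤP.neg-distrib-+ δ δ) ⟨
      ∣ ℤ.- (δ ℤ.+ δ) ∣                            ≡⟨ ℤP.∣-i∣≡∣i∣ (δ ℤ.+ δ) ⟩
      ∣ δ ℤ.+ δ ∣                                  ∎
      where open ≡-Reasoning

  T-locating : ∀ u v → ¬ u ∈S T → ¬ v ∈S T → ¬ u ≡ v →
    ¬ (∀ w → ((Adj u w × w ∈S T) ⇔ (Adj v w × w ∈S T)))
  T-locating u v u∉T v∉T u≢v sameTrace = locate (∉T u∉T) (∉T v∉T)
    where
    u→v : SameTrace u v
    u→v w adj w∈ = proj₁ (Equivalence.to (sameTrace w) (adj , w∈))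
    v→u : SameTrace v u
    v→u w adj w∈ = proj₁ (Equivalence.from (sameTrace w) (adj , w∈))
    locate : ¬ u ∈S columns ⊎ (u ∈S columns × u ≡ d) → ¬ v ∈S columns ⊎ (v ∈S columns × v ≡ d) → ⊥
    locate (inj₁ u∉) (inj₁ v∉) = u≢v (gaps-separated u∉ v∉ u→v v→u)
    locate (inj₁ u∉) (inj₂ (v∈ , v≡d)) = gap-vs-removed u∉ v∈ v≡d u→v v→u
    locate (inj₂ (u∈ , u≡d)) (inj₁ v∉) = gap-vs-removed v∉ u∈ u≡d v→u u→v
    locate (inj₂ (_ , u≡d)) (inj₂ (_ , v≡d)) = u≢v (trans u≡d (sym v≡d))

  removeColumns-LD : IsLD T
  removeColumns-LD = T-dominating , T-locating

IsLD-resp-≗ : ∀ {S S′ : VSet} → S ≗ S′ → IsLD S → IsLD S′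
IsLD-resp-≗ {S} {S′} S≗S′ (dominating , locating) = dominating′ , locating′
  where
  to : ∀ {v} → v ∈S S → v ∈S S′
  to {v} = trans (sym (S≗S′ v))
  from : ∀ {v} → v ∈S S′ → v ∈S S
  from {v} = trans (S≗S′ v)
  dominating′ : ∀ v → ¬ v ∈S S′ → ∃ λ w → Adj v w × w ∈S S′
  dominating′ v v∉ with dominating v (v∉ ∘ to)
  ... | w , adj , w∈ = w , adj , to w∈
  locating′ : ∀ u v → ¬ u ∈S S′ → ¬ v ∈S S′ → ¬ u ≡ v →
    ¬ (∀ w → ((Adj u w × w ∈S S′) ⇔ (Adj v w × w ∈S S′)))
  locating′ u v u∉ v∉ u≢v sameTrace = locating u v (u∉ ∘ to) (v∉ ∘ to) u≢v λ w →
    mk⇔ (λ (adj , w∈) → let (adj′ , w∈′) = Equivalence.to (sameTrace w) (adj , to w∈) in adj′ , from w∈′)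
        (λ (adj , w∈) → let (adj′ , w∈′) = Equivalence.from (sameTrace w) (adj , to w∈) in adj′ , from w∈′)

removeColumns-gap : remove columns (-1ℤ , 0ℤ) ≗ columns
removeColumns-gap w with w ≟V (-1ℤ , 0ℤ)
... | yes refl = refl
... | no _ = ∧-identityʳ (columns w)

columns-RedLD : IsRedLD columns
columns-RedLD = IsLD-resp-≗ removeColumns-gap (removeColumns-LD (-1ℤ , 0ℤ)) , λ d _ → removeColumns-LD d

-- Counting the columns in a ball

mirror : V → V
mirror (x , y) = (ℤ.- x , y)

mirror-involutive : ∀ v → mirror (mirror v) ≡ v
mirror-involutive (x , y) = cong (_, y) (ℤP.neg-involutive x)

east-mirror : ∀ v → east (mirror v) ≡ mirror (west v)
east-mirror (x , y) = cong (_, y) (flip x)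
  where
  flip : ∀ x → ℤ.- x ℤ.+ 1ℤ ≡ ℤ.- (x ℤ.- 1ℤ)
  flip = ℤSolver.solve-∀

west-mirror : ∀ v → west (mirror v) ≡ mirror (east v)
west-mirror (x , y) = cong (_, y) (flip x)
  where
  flip : ∀ x → ℤ.- x ℤ.- 1ℤ ≡ ℤ.- (x ℤ.+ 1ℤ)
  flip = ℤSolver.solve-∀

vert-mirror : ∀ v → vert (mirror v) ≡ mirror (vert v)
vert-mirror (x , y) rewrite isEven-neg-+ x y = refl

inBall-mirror : ∀ r v → inBall r (mirror v) ≡ inBall r v
inBall-mirror zero v with mirror v ≟V origin | v ≟V origin
... | yes _ | yes _ = refl
... | no _ | no _ = refl
... | yes m≡o | no v≢o = contradiction (trans (sym (mirror-involutive v)) (cong mirror m≡o)) v≢o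
... | no m≢o | yes refl = contradiction refl m≢o
inBall-mirror (suc r) v = begin
  inBall r (mirror v) ∨ (inBall r (east (mirror v)) ∨ (inBall r (west (mirror v)) ∨ (inBall r (vert (mirror v)) ∨ false)))
    ≡⟨ cong₂ _∨_ (inBall-mirror r v)
         (cong₂ _∨_ (via (east-mirror v)) (cong₂ _∨_ (via (west-mirror v)) (cong (_∨ false) (via (vert-mirror v))))) ⟩
  inBall r v ∨ (inBall r (west v) ∨ (inBall r (east v) ∨ (inBall r (vert v) ∨ false)))
    ≡⟨ cong (inBall r v ∨_) (swap (inBall r (west v)) (inBall r (east v)) _) ⟩
  inBall r v ∨ (inBall r (east v) ∨ (inBall r (west v) ∨ (inBall r (vert v) ∨ false)))
    ∎
  where
  open ≡-Reasoning
  via : ∀ {w u} → w ≡ mirror u → inBall r w ≡ inBall r u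
  via {u = u} w≡ = trans (cong (inBall r) w≡) (inBall-mirror r u)
  swap : ∀ a b c → a ∨ (b ∨ c) ≡ b ∨ (a ∨ c)
  swap a b c = trans (sym (∨-assoc a b c)) (trans (cong (_∨ c) (∨-comm a b)) (∨-assoc b a c))

onAxis : V → Bool
onAxis (x , _) = ⌊ x ℤ.≟ 0ℤ ⌋

onAxis⇒≡ : ∀ {v} → v ∈S onAxis → v ≡ (0ℤ , proj₂ v)
onAxis⇒≡ {x , y} on with x ℤ.≟ 0ℤ
... | yes refl = refl

off-axis : ∀ {v} → not (onAxis v) ≡ true → ¬ proj₁ v ≡ 0ℤ
off-axis () refl

module _ (r : ℕ) where

  ballDetector : V → Bool
  ballDetector v = inBall r v ∧ columns v

  axis-count : countBool (box r) (λ v → ballDetector v ∧ onAxis v) ≤ suc (2 * r)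
  axis-count = begin
    countBool (box r) (λ v → ballDetector v ∧ onAxis v)     ≤⟨ countBool-≤-injection id {Q = λ _ → true} id axis (box-unique r) maps ⟩
    countBool axis (λ _ → true)                              ≡⟨ countBool-const-true axis ⟩
    length axis                                              ≡⟨ length-map axisPoint (range r) ⟩
    length (range r)                                         ≡⟨ length-range r ⟩
    suc (2 * r)                                              ∎
    where
    open ≤-Reasoning
    axisPoint : ℤ → V
    axisPoint y = (0ℤ , y)
    axis : List V
    axis = map axisPoint (range r)
    maps : ∀ {v} → v ∈ box r → (ballDetector v ∧ onAxis v) ≡ true → v ∈ axis × true ≡ true
    maps {v} v∈ counted =
      subst (_∈ axis) (sym (onAxis⇒≡ (∧-conicalʳ _ _ counted))) (∈-map⁺ axisPoint (∈-range⁺ r (proj₂ (∈-box⁻ r v∈)))) , refl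

  mirror-count : countBool (box r) (λ v → ballDetector v ∧ not (onAxis v)) ≤ countBool (box r) (λ v → inBall r v ∧ not (columns v))
  mirror-count = countBool-≤-injection mirror (injective-by mirror mirror mirror-involutive) (box r) (box-unique r) maps
    where
    maps : ∀ {v} → v ∈ box r → (ballDetector v ∧ not (onAxis v)) ≡ true →
      mirror v ∈ box r × (inBall r (mirror v) ∧ not (columns (mirror v))) ≡ true
    maps {v} _ counted = inBall⇒∈box r mirror∈B , cong₂ _∧_ mirror∈B (cong not mirror∉)
      where
      mirror∈B : mirror v ∈S inBall r
      mirror∈B = trans (inBall-mirror r v) (∧-conicalˡ _ _ (∧-conicalˡ _ _ counted))
      mirror∉ : columns (mirror v) ≡ false
      mirror∉ = ¬-not {y = true} λ mirror∈ →
        off-axis {v} (∧-conicalʳ (ballDetector v) _ counted) (mirror-detectors (proj₁ v) v∈ mirror∈)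
        where
        v∈ : v ∈S columns
        v∈ = ∧-conicalʳ (inBall r v) _ (∧-conicalˡ _ _ counted)

  columns-count : 2 * ballCount columns r ≤ ballSize r + suc (2 * r)
  columns-count = begin
    2 * C                       ≡⟨ cong (_+_ C) (+-identityʳ C) ⟩
    C + C                       ≡⟨ cong (_+_ C) (countBool-split (box r) ballDetector onAxis) ⟩
    C + (onAxisC + offAxisC)    ≤⟨ +-monoʳ-≤ C (+-monoʳ-≤ onAxisC mirror-count) ⟩
    C + (onAxisC + gapC)        ≡⟨ trans (cong (_+_ C) (+-comm onAxisC gapC)) (sym (+-assoc C gapC onAxisC)) ⟩
    C + gapC + onAxisC          ≡⟨ cong (_+ onAxisC) (countBool-split (box r) (inBall r) columns) ⟨
    ballSize r + onAxisC        ≤⟨ +-monoʳ-≤ (ballSize r) axis-count ⟩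
    ballSize r + suc (2 * r)    ∎
    where
    open ≤-Reasoning
    C = ballCount columns r
    onAxisC = countBool (box r) (λ v → ballDetector v ∧ onAxis v)
    offAxisC = countBool (box r) (λ v → ballDetector v ∧ not (onAxis v))
    gapC = countBool (box r) (λ v → inBall r v ∧ not (columns v))

toℚᵘ-fromℕ : ∀ n → toℚᵘ (fromℕ n) ≡ mkℚᵘ (+ n) 0
toℚᵘ-fromℕ n = cong toℚᵘ (ℚP.normalize-coprime (Coprimality.sym (1-coprimeTo n)))

toℚᵘ-*-fromℕ : ∀ q n → toℚᵘ (q ℚ.* fromℕ n) ℚᵘ.≃ toℚᵘ q ℚᵘ.* mkℚᵘ (+ n) 0
toℚᵘ-*-fromℕ q n = ℚᵘP.≃-trans (ℚP.toℚᵘ-homo-* q (fromℕ n)) (ℚᵘP.*-congˡ {toℚᵘ q} (ℚᵘP.≃-reflexive (toℚᵘ-fromℕ n)))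

-- Cross-multiplied form of C ≤ (1/2 + n/d) B.
≤-half-plusᶻ : ∀ d n B C → 2 * d * C ≤ d * B + 2 * n * B →
  + C ℤ.* + (2 * d * 1) ℤ.≤ ((+ 1 ℤ.* + d ℤ.+ + n ℤ.* + 2) ℤ.* + B) ℤ.* + 1
≤-half-plusᶻ d n B C hyp = begin
  + C ℤ.* + (2 * d * 1)                                 ≡⟨ ℤP.pos-* C (2 * d * 1) ⟨
  + (C * (2 * d * 1))                                   ≤⟨ +≤+ (≤-trans (≤-reflexive (lhs C d)) (≤-trans hyp (≤-reflexive (rhs d n B)))) ⟩
  + ((1 * d + n * 2) * B * 1)                           ≡⟨ ℤP.pos-* ((1 * d + n * 2) * B) 1 ⟩
  + ((1 * d + n * 2) * B) ℤ.* + 1                       ≡⟨ cong (ℤ._* + 1) (ℤP.pos-* (1 * d + n * 2) B) ⟩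
  + (1 * d + n * 2) ℤ.* + B ℤ.* + 1                     ≡⟨ cong (λ z → z ℤ.* + B ℤ.* + 1)
                                                             (trans (ℤP.pos-+ (1 * d) (n * 2)) (cong₂ ℤ._+_ (ℤP.pos-* 1 d) (ℤP.pos-* n 2))) ⟩
  (+ 1 ℤ.* + d ℤ.+ + n ℤ.* + 2) ℤ.* + B ℤ.* + 1         ∎
  where
  open ℤP.≤-Reasoning
  lhs : ∀ C d → C * (2 * d * 1) ≡ 2 * d * C
  lhs = ℕSolver.solve-∀
  rhs : ∀ d n B → d * B + 2 * n * B ≡ (1 * d + n * 2) * B * 1
  rhs = ℕSolver.solve-∀

-- Cross-multiplied form of (1/2 - n/d) B ≤ C.
half-minus-≤ᶻ : ∀ d n B C → d * B ≤ 2 * d * C + 2 * n * B →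
  ((+ 1 ℤ.* + d ℤ.+ ℤ.- (+ n) ℤ.* + 2) ℤ.* + B) ℤ.* + 1 ℤ.≤ + C ℤ.* + (2 * d * 1)
half-minus-≤ᶻ d n B C hyp = begin
  ((+ 1 ℤ.* + d ℤ.+ ℤ.- (+ n) ℤ.* + 2) ℤ.* + B) ℤ.* + 1   ≡⟨ expand (+ d) (+ n) (+ B) ⟩
  + d ℤ.* + B ℤ.- + 2 ℤ.* + n ℤ.* + B                      ≡⟨ cong₂ ℤ._-_ (ℤP.pos-* d B)
                                                                (trans (ℤP.pos-* (2 * n) B) (cong (ℤ._* + B) (ℤP.pos-* 2 n))) ⟨
  + (d * B) ℤ.- + (2 * n * B)                              ≤⟨ ℤP.+-monoˡ-≤ (ℤ.- + (2 * n * B))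
                                                                (+≤+ (≤-trans hyp (≤-reflexive (rearrange C d n B)))) ⟩
  + (C * (2 * d * 1) + 2 * n * B) ℤ.- + (2 * n * B)        ≡⟨ cong (ℤ._- + (2 * n * B)) (ℤP.pos-+ (C * (2 * d * 1)) (2 * n * B)) ⟩
  + (C * (2 * d * 1)) ℤ.+ + (2 * n * B) ℤ.- + (2 * n * B)  ≡⟨ cancel (+ (C * (2 * d * 1))) (+ (2 * n * B)) ⟩
  + (C * (2 * d * 1))                                      ≡⟨ ℤP.pos-* C (2 * d * 1) ⟩
  + C ℤ.* + (2 * d * 1)                                    ∎
  where
  open ℤP.≤-Reasoning
  expand : ∀ d n b → ((+ 1 ℤ.* d ℤ.+ ℤ.- n ℤ.* + 2) ℤ.* b) ℤ.* + 1 ≡ d ℤ.* b ℤ.- + 2 ℤ.* n ℤ.* b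
  expand = ℤSolver.solve-∀
  rearrange : ∀ C d n B → 2 * d * C + 2 * n * B ≡ C * (2 * d * 1) + 2 * n * B
  rearrange = ℕSolver.solve-∀
  cancel : ∀ a b → a ℤ.+ b ℤ.- b ≡ a
  cancel = ℤSolver.solve-∀

≤-half-plus : ∀ ε → Positive ε → ∃ λ k → ∀ B C → 2 * suc k * C ≤ suc k * B + 2 * B →
  fromℕ C ℚ.≤ (½ ℚ.+ ε) ℚ.* fromℕ B
≤-half-plus ε@(mkℚ (+ suc n) d-1 _) _ = d-1 , λ B C hyp →
  ℚP.toℚᵘ-cancel-≤
    (ℚᵘP.≤-respʳ-≃ (ℚᵘP.≃-sym (ℚᵘP.≃-trans (toℚᵘ-*-fromℕ (½ ℚ.+ ε) B) (ℚᵘP.*-congʳ (ℚP.toℚᵘ-homo-+ ½ ε))))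
      (ℚᵘP.≤-respˡ-≃ (ℚᵘP.≃-sym (ℚᵘP.≃-reflexive (toℚᵘ-fromℕ C)))
        (*≤* (≤-half-plusᶻ (suc d-1) (suc n) B C
          (≤-trans hyp (+-monoʳ-≤ (suc d-1 * B) (*-monoˡ-≤ B (*-monoʳ-≤ 2 {1} {suc n} (s≤s z≤n)))))))))

half-minus-≤ : ∀ ε → Positive ε → ∃ λ k → ∀ B C → C ≤ B → suc k * B ≤ 2 * suc (suc k) * C →
  (½ ℚ.- ε) ℚ.* fromℕ B ℚ.≤ fromℕ C
half-minus-≤ ε@(mkℚ (+ suc n) d-1 _) _ = d-1 , λ B C C≤B hyp →
  ℚP.toℚᵘ-cancel-≤
    (ℚᵘP.≤-respˡ-≃ (ℚᵘP.≃-sym (ℚᵘP.≃-trans (toℚᵘ-*-fromℕ (½ ℚ.- ε) B)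
        (ℚᵘP.*-congʳ (ℚᵘP.≃-trans (ℚP.toℚᵘ-homo-+ ½ (ℚ.- ε)) (ℚᵘP.+-congʳ (toℚᵘ ½) (ℚP.toℚᵘ-homo‿- ε))))))
      (ℚᵘP.≤-respʳ-≃ (ℚᵘP.≃-sym (ℚᵘP.≃-reflexive (toℚᵘ-fromℕ C)))
        (*≤* (half-minus-≤ᶻ (suc d-1) (suc n) B C (≤-trans hyp (weaken (suc d-1) C≤B))))))
  where
  weaken : ∀ d {B C} → C ≤ B → 2 * suc d * C ≤ 2 * d * C + 2 * suc n * B
  weaken d {B} {C} C≤B = begin
    2 * suc d * C               ≡⟨ split d C ⟩
    2 * d * C + 2 * C           ≤⟨ +-monoʳ-≤ (2 * d * C) (*-mono-≤ 2≤2+2n C≤B) ⟩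
    2 * d * C + 2 * suc n * B   ∎
    where
    open ≤-Reasoning
    2≤2+2n : 2 ≤ 2 * suc n
    2≤2+2n = *-monoʳ-≤ 2 (s≤s z≤n)
    split : ∀ d C → 2 * suc d * C ≡ 2 * d * C + 2 * C
    split = ℕSolver.solve-∀

-- With m = ⌊r/4⌋ ≥ 4K: K(2r + 1) ≤ 8K(m + 1) ≤ 2m(m + 1) ≤ 2(2m + 1)².
quarter-square : ∀ K r → 16 * K ≤ r → K * suc (2 * r) ≤ 2 * (suc (2 * (r / 4)) * suc (2 * (r / 4)))
quarter-square K r 16K≤r = begin
  K * suc (2 * r)                             ≤⟨ *-monoʳ-≤ K 2r+1≤ ⟩
  K * (8 * suc m)                             ≡⟨ regroup K m ⟩
  2 * (4 * K * suc m)                         ≤⟨ *-monoʳ-≤ 2 (*-mono-≤ (≤-trans 4K≤m m≤2m+1) (s≤s m≤2m)) ⟩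
  2 * (suc (2 * m) * suc (2 * m))             ∎
  where
  open ≤-Reasoning
  m = r / 4
  m≤2m : m ≤ 2 * m
  m≤2m = m≤m+n m (m + 0)
  m≤2m+1 : m ≤ suc (2 * m)
  m≤2m+1 = m≤n⇒m≤1+n m≤2m
  regroup : ∀ K m → K * (8 * suc m) ≡ 2 * (4 * K * suc m)
  regroup = ℕSolver.solve-∀
  r<4m+4 : r < 4 + m * 4
  r<4m+4 = subst (_< 4 + m * 4) (sym (m≡m%n+[m/n]*n r 4)) (+-monoˡ-< (m * 4) (m%n<n r 4))
  2r+1≤ : suc (2 * r) ≤ 8 * suc m
  2r+1≤ = ≤-trans (n≤1+n _) (≤-trans (≤-reflexive (sym (*-suc 2 r))) (≤-trans (*-monoʳ-≤ 2 r<4m+4) (≤-reflexive (double m))))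
    where
    double : ∀ m → 2 * (4 + m * 4) ≡ 8 * suc m
    double = ℕSolver.solve-∀
  4K≤m : 4 * K ≤ m
  4K≤m = subst (_≤ m) (m*n/n≡m (4 * K) 4) (/-monoˡ-≤ 4 (subst (_≤ r) (sixteen K) 16K≤r))
    where
    sixteen : ∀ K → 16 * K ≡ 4 * K * 4
    sixteen = ℕSolver.solve-∀

redLD-density-≥½ : ∀ S → IsRedLD S → DensityGE S ½
redLD-density-≥½ S redLD ε ε>0 R with half-minus-≤ ε ε>0
... | k , ratio with slowStep-unbounded ballSize k ballSize-pos ballSize-≤ R
... | r , R≤r , slow = suc r , m≤n⇒m≤1+n R≤r ,
  ratio (ballSize (suc r)) (ballCount S (suc r)) (ballCount≤ballSize S (suc r)) (begin
    suc k * ballSize (suc r)                   ≤⟨ slow ⟩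
    suc (suc k) * ballSize r                   ≤⟨ *-monoʳ-≤ (suc (suc k)) (ballSize≤2*ballCount S redLD r) ⟩
    suc (suc k) * (2 * ballCount S (suc r))    ≡⟨ swap (suc (suc k)) (ballCount S (suc r)) ⟩
    2 * suc (suc k) * ballCount S (suc r)      ∎)
  where
  open ≤-Reasoning
  swap : ∀ a c → a * (2 * c) ≡ 2 * a * c
  swap = ℕSolver.solve-∀

columns-density-≤½ : DensityLE columns ½
columns-density-≤½ ε ε>0 with ≤-half-plus ε ε>0
... | k , ratio = 16 * suc k , λ r 16K≤r → ratio (ballSize r) (ballCount columns r) (begin
    2 * suc k * ballCount columns r                ≡⟨ swap (suc k) (ballCount columns r) ⟩
    suc k * (2 * ballCount columns r)              ≤⟨ *-monoʳ-≤ (suc k) (columns-count r) ⟩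
    suc k * (ballSize r + suc (2 * r))             ≡⟨ *-distribˡ-+ (suc k) (ballSize r) (suc (2 * r)) ⟩
    suc k * ballSize r + suc k * suc (2 * r)       ≤⟨ +-monoʳ-≤ (suc k * ballSize r) (axis≤ r 16K≤r) ⟩
    suc k * ballSize r + 2 * ballSize r            ∎)
  where
  open ≤-Reasoning
  swap : ∀ a c → 2 * a * c ≡ a * (2 * c)
  swap = ℕSolver.solve-∀
  axis≤ : ∀ r → 16 * suc k ≤ r → suc k * suc (2 * r) ≤ 2 * ballSize r
  axis≤ r 16K≤r = ≤-trans (quarter-square (suc k) r 16K≤r) (*-monoʳ-≤ 2 (ballSize-≥ {r / 4} {r} 4[r/4]≤r))
    where
    4[r/4]≤r : 4 * (r / 4) ≤ r
    4[r/4]≤r = subst (_≤ r) (*-comm (r / 4) 4) (m/n*n≤m r 4)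

theorem18 : (∃ λ S → IsRedLD S × DensityEq S ½) × (∀ S → IsRedLD S → DensityGE S ½)
theorem18 = (columns , columns-RedLD , columns-density-≤½ , redLD-density-≥½ columns columns-RedLD) , redLD-density-≥½
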